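{- Let $k\ge 2$ and $q\ge 1$ be integers and let $\mathbf{v}\in W_{k,q}$ be a vertex of $T_{k,q}$ lying in the interior of $R_{k,q}$ (i.e. $0<v_1<v_2<\cdots<v_{k-1}<q$). Then $\mathrm{link}_{T_{k,q}}(\mathbf{v})$ is isomorphic (as a simplicial complex) to the barycentric subdivision of the boundary of the $(k-1)$-simplex, i.e. $\mathrm{link}_{T_{k,q}}(\mathbf{v})\cong Sd(\partial\Delta^{k-1})=\Delta(\overline{B}_k)$.
   Context: $R_{k,q}=\{\mathbf{x}\in\mathbb{R}^{k-1}:0\le x_1\le\cdots\le x_{k-1}\le q\}$ is a $(k-1)$-simplex and $W_{k,q}=R_{k,q}\cap\mathbb{Z}^{k-1}$. A permutation $\pi=\pi_1\cdots\pi_{k-1}$ of $[k-1]$ is consistent with $\mathbf{v}\in W_{k,q}$ if $i$ appears before $i+1$ in $\pi$ whenever $v_i=v_{i+1}$. For such a pair, $F(\mathbf{v},\pi)$ is the simplex with vertices $\mathbf{v}^{(1)}=\mathbf{v}$ and $\mathbf{v}^{(m+1)}=\mathbf{v}^{(m)}+e_{\pi_{k-m}}$ for $m=1,\dots,k-1$ ($e_i$ the standard basis vectors of $\mathbb{R}^{k-1}$). The edgewise subdivision $T_{k,q}$ is the simplicial complex (a triangulation of $R_{k,q}$) with vertex set $W_{k,q}$ whose facets are all such $F(\mathbf{v},\pi)$. For a face $\sigma$ of a complex $K$, $\mathrm{link}_K(\sigma)=\{\tau\in K:\sigma\cup\tau\in K,\ \sigma\cap\tau=\emptyset\}$. $B_k$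 is the Boolean lattice of subsets of $[k]$, $\overline{B}_k=B_k\setminus\{\emptyset,[k]\}$, and $\Delta(P)$ denotes the order complex of a poset $P$ (faces are chains). -}

module Defs where

open import Data.Nat using (ℕ; zero; suc; _+_; _≤_; _<_; _∸_)
open import Data.Bool using (if_then_else_)
open import Data.Fin using (Fin; toℕ; _≟_)
open import Data.Fin.Permutation using (Permutation′; _⟨$⟩ʳ_; _⟨$⟩ˡ_)
open import Data.Fin.Subset using (Subset; _⊆_; Nonempty; ⊤)
open import Data.Vec using (Vec; lookup; tabulate; zipWith; toList)
open import Data.List using (List; []; _∷_; [_]; map; scanl; reverse; allFin; _++_; _∷ʳ_)
open import Data.List.Membership.Propositional using (_∈_; _∉_)
open import Data.List.Relation.Unary.All using (All)
open import Data.List.Relation.Unary.Linked using (Linked)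
open import Data.Product using (Σ; _×_; ∃; ∃-syntax)
open import Data.Sum using (_⊎_)
open import Relation.Binary.PropositionalEquality using (_≡_; _≢_)
open import Relation.Nullary.Decidable using (⌊_⌋)
open import Function.Bundles using (_⇔_)

-- Abstract simplicial complexes, given by their face predicate on
-- finite vertex lists (a list stands for the finite set of its members).

Complex : Set → Set₁
Complex V = List V → Set

-- Simplicial isomorphism: mutually inverse vertex bijections between the
-- vertex sets (vertices = x with [ x ] a face) such that a finite set of
-- vertices is a face of K iff its image is a face of L.
record _≅_ {V W : Set} (K : Complex V) (L : Complex W) : Set where
  field
    to       : V → W
    from     : W → V
    to-vert  : ∀ x → K [ x ] → L [ to x ]
    from-vert : ∀ y → L [ y ] → K [ from y ]
    from∘to  : ∀ x → K [ x ] → from (to x) ≡ x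
    to∘from  : ∀ y → L [ y ] → to (from y) ≡ y
    faces    : ∀ (σ : List V) → All (λ x → K [ x ]) σ → (K σ ⇔ L (map to σ))

Link : {V : Set} → Complex V → V → Complex V
Link K v τ = (v ∉ τ) × K (v ∷ τ)

OrderComplex : {A : Set} → (A → Set) → (A → A → Set) → Complex A
OrderComplex P _≤ₚ_ σ =
  All P σ × (∀ {x y} → x ∈ σ → y ∈ σ → (x ≤ₚ y) ⊎ (y ≤ₚ x))

-- Edgewise subdivision T_{k,q}; vectors live in ℕ^(k-1) (0-indexed coords).

InW : (k q : ℕ) → Vec ℕ (k ∸ 1) → Set
InW k q x = Linked _≤_ ((0 ∷ toList x) ∷ʳ q)

Interior : (k q : ℕ) → Vec ℕ (k ∸ 1) → Set
Interior k q x = Linked _<_ ((0 ∷ toList x) ∷ʳ q)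

e : {n : ℕ} → Fin n → Vec ℕ n
e i = tabulate (λ j → if ⌊ i ≟ j ⌋ then 1 else 0)

_+ᵥ_ : {n : ℕ} → Vec ℕ n → Vec ℕ n → Vec ℕ n
_+ᵥ_ = zipWith _+_

-- π (a permutation of [n], π_i = π ⟨$⟩ʳ i, position of value i = π ⟨$⟩ˡ i)
-- is consistent with v: i appears before i+1 whenever v_i = v_{i+1}.
Consistent : {n : ℕ} → Vec ℕ n → Permutation′ n → Set
Consistent {n} v π = ∀ (i j : Fin n) → toℕ j ≡ suc (toℕ i) →
  lookup v i ≡ lookup v j → toℕ (π ⟨$⟩ˡ i) < toℕ (π ⟨$⟩ˡ j)

-- vertices v^(1), ..., v^(n+1) of F(v,π):
-- v^(1) = v, v^(m+1) = v^(m) + e_{π_{n+1-m}}, i.e. add e_{π_n}, e_{π_{n-1}}, ..., e_{π_1}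
facetVerts : {n : ℕ} → Vec ℕ n → Permutation′ n → List (Vec ℕ n)
facetVerts {n} v π =
  scanl (λ w i → w +ᵥ e i) v (reverse (map (π ⟨$⟩ʳ_) (allFin n)))

T : (k q : ℕ) → Complex (Vec ℕ (k ∸ 1))
T k q σ = ∃[ v ] Σ (Permutation′ (k ∸ 1)) λ π →
  InW k q v × Consistent v π × All (λ w → w ∈ facetVerts v π) σ

ProperNonempty : {k : ℕ} → Subset k → Set
ProperNonempty p = Nonempty p × p ≢ ⊤

-- Write x ≼ y when y − x ∈ {0,1}^(k−1). The vertices of a facet F(w,π) are the points
-- w + 𝟙[t ≤ π⁻¹ c], so every face of T_{k,q} is a ≼-chain. Conversely a ≼-chain through the
-- interior vertex v lies in F(w,π), where w is its coordinatewise minimum and π orders the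
-- coordinates by how many members are raised above w there; interiority of v makes w a
-- point of W_{k,q} and π consistent with w. So the link of v consists of the ≼-chains of
-- vertices x ≠ v comparable with v. Such a vertex is x = v − b·𝟙 + 𝟙_S for a bit b and a
-- set S of coordinates, and x ↦ b ∷ S is a bijection onto the proper nonempty subsets of
-- [k] under which ≼-comparability becomes comparability under inclusion.

module Submission where

open import Defs
open import Data.Bool.Base as Bool using (Bool; true; false; if_then_else_; _∧_; f≤t; b≤b)
import Data.Bool.Properties as Boolₚ
open import Data.Fin.Base as Fin using (Fin; toℕ; fromℕ; fromℕ<; inject₁; punchOut)
import Data.Fin.Properties as Finₚ
open import Data.Fin.Permutation using (Permutation′; _⟨$⟩ʳ_; _⟨$⟩ˡ_; permutation; inverseˡ; inverseʳ)
open import Data.Fin.Subset as Subset using (Subset; _⊆_; Nonempty)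
open import Data.Fin.Subset.Properties using (Empty-unique; nonempty?; ∉⊥; ⊆-refl)
open import Data.List.Base as List using (List; []; _∷_; [_]; map; filter; length; reverse; allFin; _∷ʳ_)
open import Data.List.Scans.Base using (scanl)
import Data.List.Properties as Listₚ
import Data.List.Relation.Unary.All.Properties as Allₚ
open import Data.List.Membership.Propositional using (_∈_; _∉_; lose)
open import Data.List.Membership.Propositional.Properties using (∈-allFin; ∈-map⁺; ∈-map⁻)
open import Data.List.Relation.Unary.All as All using (All)
open import Data.List.Relation.Unary.Any using (here; there)
open import Data.List.Extrema.Nat using (argmin; argmin-sel; f[argmin]≤f[⊤]; f[argmin]≤f[xs])
open import Data.List.Relation.Unary.Linked using (Linked; [-]; _∷_)
open import Data.Nat.Base using (ℕ; zero; suc; _+_; _∸_; _≤_; _<_; z≤n; s≤s)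
open import Data.Nat.Properties
open import Data.Product using (∃-syntax; _×_; _,_; proj₁; proj₂)
open import Data.Product.Relation.Binary.Lex.Strict using (×-strictTotalOrder)
open import Data.Sum using (_⊎_; inj₁; inj₂; swap)
open import Data.Vec.Base as Vec using (Vec; lookup; tabulate; toList; replicate)
open import Data.Vec.Properties
  using (lookup∘tabulate; lookup-zipWith; lookup-replicate; []=⇒lookup; lookup⇒[]=)
open import Data.Vec.Relation.Binary.Pointwise.Extensional as Pointwise using (Pointwise; ext; Pointwise-≡⇒≡)
open Pointwise.Pointwise using (app)
open import Function.Base using (_∘_; id)
open import Function.Bundles using (_⇔_; mk⇔; Equivalence)
open import Function.Properties.Equivalence using () renaming (trans to ⇔-trans)
open import Function.Definitions using (Injective)
open import Level using (0ℓ; _⊔_)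
open import Relation.Binary.Bundles using (StrictTotalOrder)
open import Relation.Binary.Core using (Rel)
open import Relation.Binary.Definitions using (Reflexive; tri<; tri≈; tri>)
open import Relation.Binary.PropositionalEquality hiding ([_])
open import Relation.Nullary using (Dec; yes; no; ¬_; contradiction)
open import Relation.Nullary.Decidable using (⌊_⌋)
open import Relation.Unary using (Pred; Decidable)

Comparable : ∀ {a ℓ} {A : Set a} → Rel A ℓ → A → A → Set ℓ
Comparable R x y = R x y ⊎ R y x

Chain : ∀ {a ℓ} {A : Set a} → Rel A ℓ → List A → Set (a ⊔ ℓ)
Chain R σ = ∀ {x y} → x ∈ σ → y ∈ σ → Comparable R x y

module _ {a ℓ} {A : Set a} {R : Rel A ℓ} where

  Chain-∷⁻ : ∀ {x σ} → Chain R (x ∷ σ) → Chain R σ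
  Chain-∷⁻ chain x∈σ y∈σ = chain (there x∈σ) (there y∈σ)

  Chain-∷⁺ : Reflexive R → ∀ {x σ} → (∀ {y} → y ∈ σ → Comparable R x y) →
             Chain R σ → Chain R (x ∷ σ)
  Chain-∷⁺ refl-R x∼σ chain (here refl) (here refl) = inj₁ refl-R
  Chain-∷⁺ refl-R x∼σ chain (here refl) (there y∈σ) = x∼σ y∈σ
  Chain-∷⁺ refl-R x∼σ chain (there x∈σ) (here refl) = swap (x∼σ x∈σ)
  Chain-∷⁺ refl-R x∼σ chain (there x∈σ) (there y∈σ) = chain x∈σ y∈σ

  Chain-[-] : Reflexive R → ∀ {x} → Chain R [ x ]
  Chain-[-] refl-R = Chain-∷⁺ refl-R (λ ()) (λ ())

  Chain-map⇔ : ∀ {b ℓ′} {B : Set b} {S : Rel B ℓ′} (f : A → B) {σ : List A} →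
    (∀ {x y} → x ∈ σ → y ∈ σ → Comparable R x y ⇔ Comparable S (f x) (f y)) →
    Chain R σ ⇔ Chain S (map f σ)
  Chain-map⇔ {S = S} f {σ} R⇔S = mk⇔ to from
    where
    to : Chain R σ → Chain S (map f σ)
    to chain fx∈ fy∈ with ∈-map⁻ f fx∈ | ∈-map⁻ f fy∈
    ... | x , x∈σ , refl | y , y∈σ , refl = Equivalence.to (R⇔S x∈σ y∈σ) (chain x∈σ y∈σ)
    from : Chain S (map f σ) → Chain R σ
    from chain x∈σ y∈σ = Equivalence.from (R⇔S x∈σ y∈σ) (chain (∈-map⁺ f x∈σ) (∈-map⁺ f y∈σ))

module _ {a p q} {A : Set a} {P : Pred A p} {Q : Pred A q} (P? : Decidable P) (Q? : Decidable Q) where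

  length-filter-≤ : ∀ xs → (∀ {x} → x ∈ xs → P x → Q x) →
                    length (filter P? xs) ≤ length (filter Q? xs)
  length-filter-≤ [] _ = z≤n
  length-filter-≤ (x ∷ xs) P⇒Q with P? x | Q? x
  ... | yes _ | yes _ = s≤s (length-filter-≤ xs (P⇒Q ∘ there))
  ... | yes px | no ¬qx = contradiction (P⇒Q (here refl) px) ¬qx
  ... | no _ | yes _ = m≤n⇒m≤1+n (length-filter-≤ xs (P⇒Q ∘ there))
  ... | no _ | no _ = length-filter-≤ xs (P⇒Q ∘ there)

  length-filter-< : ∀ xs → (∀ {x} → x ∈ xs → P x → Q x) → ∀ {y} → y ∈ xs → Q y → ¬ P y →
                    length (filter P? xs) < length (filter Q? xs)
  length-filter-< (x ∷ xs) P⇒Q (here refl) qx ¬px with P? x | Q? x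
  ... | yes px | _ = contradiction px ¬px
  ... | no _ | no ¬qx = contradiction qx ¬qx
  ... | no _ | yes _ = s≤s (length-filter-≤ xs (P⇒Q ∘ there))
  length-filter-< (x ∷ xs) P⇒Q (there y∈xs) qy ¬py with P? x | Q? x
  ... | yes _ | yes _ = s≤s (length-filter-< xs (P⇒Q ∘ there) y∈xs qy ¬py)
  ... | yes px | no ¬qx = contradiction (P⇒Q (here refl) px) ¬qx
  ... | no _ | yes _ = m<n⇒m<1+n (length-filter-< xs (P⇒Q ∘ there) y∈xs qy ¬py)
  ... | no _ | no _ = length-filter-< xs (P⇒Q ∘ there) y∈xs qy ¬py

injective⇒surjective : ∀ {n} {f : Fin n → Fin n} → Injective _≡_ _≡_ f → ∀ y → ∃[ x ] f x ≡ y
injective⇒surjective {suc n} {f} f-injective y with Finₚ.any? (λ x → f x Finₚ.≟ y)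
... | yes hit = hit
... | no miss = contradiction (Finₚ.injective⇒≤ punchOut∘f-injective) (n≮n n)
  where
  y≢f : ∀ x → y ≢ f x
  y≢f x y≡fx = miss (x , sym y≡fx)
  punchOut∘f-injective : Injective _≡_ _≡_ (λ x → punchOut (y≢f x))
  punchOut∘f-injective eq = f-injective (Finₚ.punchOut-injective (y≢f _) (y≢f _) eq)

upwardClosed-threshold : ∀ {n p} {P : Pred (Fin n) p} → Decidable P →
  (∀ {i j} → toℕ i ≤ toℕ j → P i → P j) → ∃[ t ] t ≤ n × (∀ i → P i ⇔ t ≤ toℕ i)
upwardClosed-threshold {zero} _ _ = 0 , z≤n , λ ()
upwardClosed-threshold {suc n} P? up with P? Fin.zero
... | yes p₀ = 0 , z≤n , λ i → mk⇔ (λ _ → z≤n) (λ _ → up z≤n p₀)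
... | no ¬p₀ with upwardClosed-threshold (P? ∘ Fin.suc) (up ∘ s≤s)
...   | t , t≤n , P∘suc⇔ = suc t , s≤s t≤n , λ where
          Fin.zero → mk⇔ (λ p₀ → contradiction p₀ ¬p₀) (λ ())
          (Fin.suc i) → mk⇔ (s≤s ∘ Equivalence.to (P∘suc⇔ i)) (Equivalence.from (P∘suc⇔ i) ∘ ≤-pred)

module SortBy {n c ℓ₁ ℓ₂} (O : StrictTotalOrder c ℓ₁ ℓ₂) (key : Fin n → StrictTotalOrder.Carrier O)
  (key-injective : ∀ {i j} → StrictTotalOrder._≈_ O (key i) (key j) → i ≡ j) where

  open StrictTotalOrder O using (compare; module Eq)
    renaming (_<_ to _⊏_; _<?_ to _⊏?_; trans to ⊏-trans; irrefl to ⊏-irrefl)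

  private
    rank : Fin n → ℕ
    rank i = length (filter (λ j → key j ⊏? key i) (allFin n))

    rank<n : ∀ i → rank i < n
    rank<n i = subst (rank i <_) (Listₚ.length-tabulate id)
      (Listₚ.filter-notAll _ (allFin n) (lose (∈-allFin i) (⊏-irrefl Eq.refl)))

    rank-monotone : ∀ {i j} → key i ⊏ key j → rank i < rank j
    rank-monotone {i} {j} i⊏j = length-filter-< (λ k → key k ⊏? key i) (λ k → key k ⊏? key j)
      (allFin n) (λ _ k⊏i → ⊏-trans k⊏i i⊏j) (∈-allFin i) i⊏j (⊏-irrefl Eq.refl)

    rankFin : Fin n → Fin n
    rankFin i = fromℕ< (rank<n i)

    toℕ-rankFin : ∀ i → toℕ (rankFin i) ≡ rank i
    toℕ-rankFin i = Finₚ.toℕ-fromℕ< (rank<n i)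

    rankFin≡⇒rank≡ : ∀ {i j} → rankFin i ≡ rankFin j → rank i ≡ rank j
    rankFin≡⇒rank≡ {i} {j} eq = trans (sym (toℕ-rankFin i)) (trans (cong toℕ eq) (toℕ-rankFin j))

    rankFin-injective : Injective _≡_ _≡_ rankFin
    rankFin-injective {i} {j} eq with compare (key i) (key j)
    ... | tri< i⊏j _ _ = contradiction (rank-monotone i⊏j) (<-irrefl (rankFin≡⇒rank≡ eq))
    ... | tri≈ _ i≈j _ = key-injective i≈j
    ... | tri> _ _ j⊏i = contradiction (rank-monotone j⊏i) (<-irrefl (rankFin≡⇒rank≡ (sym eq)))

    unrank : Fin n → Fin n
    unrank y = proj₁ (injective⇒surjective rankFin-injective y)

    rankFin∘unrank : ∀ y → rankFin (unrank y) ≡ y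
    rankFin∘unrank y = proj₂ (injective⇒surjective rankFin-injective y)

  opaque
    sorting : Permutation′ n
    sorting = permutation unrank rankFin (rankFin-injective ∘ rankFin∘unrank ∘ rankFin) rankFin∘unrank

    sorting-monotone : ∀ {i j} → key i ⊏ key j → toℕ (sorting ⟨$⟩ˡ i) < toℕ (sorting ⟨$⟩ˡ j)
    sorting-monotone {i} {j} i⊏j =
      subst₂ _<_ (sym (toℕ-rankFin i)) (sym (toℕ-rankFin j)) (rank-monotone i⊏j)

⟦_⟧ : Bool → ℕ
⟦ b ⟧ = if b then 1 else 0

_≼_ : ℕ → ℕ → Set
a ≼ b = ∃[ s ] b ≡ ⟦ s ⟧ + a

≼-refl : ∀ {a} → a ≼ a
≼-refl = false , refl

≼⇒≤ : ∀ {a b} → a ≼ b → a ≤ b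
≼⇒≤ (false , refl) = ≤-refl
≼⇒≤ (true , refl) = n≤1+n _

≼⇒≤suc : ∀ {a b} → a ≼ b → b ≤ suc a
≼⇒≤suc (false , refl) = n≤1+n _
≼⇒≤suc (true , refl) = ≤-refl

⟦s⟧+a≼⟦s′⟧+a⇔s≤s′ : ∀ {s s′ a} → (⟦ s ⟧ + a) ≼ (⟦ s′ ⟧ + a) ⇔ s Bool.≤ s′
⟦s⟧+a≼⟦s′⟧+a⇔s≤s′ {s} {s′} = mk⇔ (to s s′) from
  where
  to : ∀ s s′ {a} → (⟦ s ⟧ + a) ≼ (⟦ s′ ⟧ + a) → s Bool.≤ s′
  to false false _ = b≤b
  to false true _ = f≤t
  to true true _ = b≤b
  to true false 1+a≼a = contradiction (≼⇒≤ 1+a≼a) (n≮n _)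
  from : ∀ {s s′ a} → s Bool.≤ s′ → (⟦ s ⟧ + a) ≼ (⟦ s′ ⟧ + a)
  from f≤t = true , refl
  from b≤b = ≼-refl

⟦s⟧+[a∸1]≼⟦s′⟧+a⇔s′≤s : ∀ {s s′ a} → 0 < a →
  (⟦ s ⟧ + (a ∸ 1)) ≼ (⟦ s′ ⟧ + a) ⇔ s′ Bool.≤ s
⟦s⟧+[a∸1]≼⟦s′⟧+a⇔s′≤s {s} {s′} {suc a} _ = mk⇔ (to s s′) from
  where
  to : ∀ s s′ → (⟦ s ⟧ + a) ≼ (⟦ s′ ⟧ + suc a) → s′ Bool.≤ s
  to false false _ = b≤b
  to true false _ = f≤t
  to true true _ = b≤b
  to false true a≼2+a = contradiction (≼⇒≤suc a≼2+a) (n≮n _)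
  from : ∀ {s s′} → s′ Bool.≤ s → (⟦ s ⟧ + a) ≼ (⟦ s′ ⟧ + suc a)
  from f≤t = false , refl
  from {false} b≤b = true , refl
  from {true} b≤b = true , refl

⟦s⟧+a≤1+a : ∀ s {a} → ⟦ s ⟧ + a ≤ suc a
⟦s⟧+a≤1+a false = n≤1+n _
⟦s⟧+a≤1+a true = ≤-refl

⟦s⟧+a≼⟦s′⟧+[a∸1]⇒s≡false : ∀ {s s′ a} → 0 < a →
  (⟦ s ⟧ + a) ≼ (⟦ s′ ⟧ + (a ∸ 1)) → s ≡ false
⟦s⟧+a≼⟦s′⟧+[a∸1]⇒s≡false {false} _ _ = refl
⟦s⟧+a≼⟦s′⟧+[a∸1]⇒s≡false {true} {s′} {suc a} _ p =
  contradiction (≤-trans (≼⇒≤ p) (⟦s⟧+a≤1+a s′)) (n≮n _)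

b≼a⇔a∸1≼b : ∀ {a b} → 0 < a → b ≼ a ⇔ (a ∸ 1) ≼ b
b≼a⇔a∸1≼b {suc a} _ = mk⇔ to from
  where
  to : ∀ {b} → b ≼ suc a → a ≼ b
  to (false , refl) = true , refl
  to (true , refl) = false , refl
  from : ∀ {b} → a ≼ b → b ≼ suc a
  from (false , refl) = true , refl
  from (true , refl) = false , refl

≼⇒≡⟦P?⟧+a : ∀ {a b} {P : Set} → a ≼ b → (b ≡ suc a ⇔ P) → (P? : Dec P) →
  b ≡ ⟦ ⌊ P? ⌋ ⟧ + a
≼⇒≡⟦P?⟧+a a≼b b≡1+a⇔P (yes p) = Equivalence.from b≡1+a⇔P p
≼⇒≡⟦P?⟧+a (false , refl) _ (no _) = refl
≼⇒≡⟦P?⟧+a (true , refl) b≡1+a⇔P (no ¬p) = contradiction (Equivalence.to b≡1+a⇔P refl) ¬p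

⌊⟦s⟧+a≟1+a⌋≡s : ∀ s a → ⌊ ⟦ s ⟧ + a ≟ suc a ⌋ ≡ s
⌊⟦s⟧+a≟1+a⌋≡s false a with a ≟ suc a
... | yes a≡1+a = contradiction (sym a≡1+a) 1+n≢n
... | no _ = refl
⌊⟦s⟧+a≟1+a⌋≡s true a with suc a ≟ suc a
... | yes _ = refl
... | no ¬refl = contradiction refl ¬refl

a≼b∧1+a≼b⇒b≡1+a : ∀ {a b} → a ≼ b → suc a ≼ b → b ≡ suc a
a≼b∧1+a≼b⇒b≡1+a a≼b 1+a≼b = ≤-antisym (≼⇒≤suc a≼b) (≼⇒≤ 1+a≼b)

a≼b∧a≼b′∧b<b′⇒b≡a∧b′≡1+a : ∀ {a b b′} → a ≼ b → a ≼ b′ → b < b′ →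
  b ≡ a × b′ ≡ suc a
a≼b∧a≼b′∧b<b′⇒b≡a∧b′≡1+a (false , refl) (true , refl) _ = refl , refl
a≼b∧a≼b′∧b<b′⇒b≡a∧b′≡1+a (false , refl) (false , refl) a<a = contradiction a<a (n≮n _)
a≼b∧a≼b′∧b<b′⇒b≡a∧b′≡1+a (true , refl) a≼b′ 1+a<b′ =
  contradiction (≤-trans 1+a<b′ (≼⇒≤suc a≼b′)) (n≮n _)

⟦b⟧+[a∸⟦b⟧]≡a : ∀ b {a} → 0 < a → ⟦ b ⟧ + (a ∸ ⟦ b ⟧) ≡ a
⟦b⟧+[a∸⟦b⟧]≡a false _ = refl
⟦b⟧+[a∸⟦b⟧]≡a true {suc a} _ = refl

_≼ᵥ_ : ∀ {n} → Vec ℕ n → Vec ℕ n → Set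
_≼ᵥ_ = Pointwise _≼_

≼ᵥ-refl : ∀ {n} → Reflexive (_≼ᵥ_ {n})
≼ᵥ-refl = Pointwise.refl ≼-refl

Comparable⇒≼ : ∀ {a b} → a ≤ b → Comparable _≼_ a b → a ≼ b
Comparable⇒≼ _ (inj₁ a≼b) = a≼b
Comparable⇒≼ _ (inj₂ (false , refl)) = ≼-refl
Comparable⇒≼ 1+b≤b (inj₂ (true , refl)) = contradiction 1+b≤b (n≮n _)

Comparable-lookup : ∀ {n} {x y : Vec ℕ n} → Comparable _≼ᵥ_ x y →
  ∀ c → Comparable _≼_ (lookup x c) (lookup y c)
Comparable-lookup (inj₁ x≼y) c = inj₁ (app x≼y c)
Comparable-lookup (inj₂ y≼x) c = inj₂ (app y≼x c)

-- Vertices of the facets F(w,π)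

band : ℕ → ℕ → ℕ → ℕ
band t m r = ⟦ ⌊ t ≤? r ⌋ ∧ ⌊ r <? m ⌋ ⟧

band-empty : ∀ m r → band m m r ≡ 0
band-empty m r with m ≤? r | r <? m
... | yes m≤r | yes r<m = contradiction (≤-<-trans m≤r r<m) (n≮n m)
... | yes _ | no _ = refl
... | no _ | _ = refl

band-suc : ∀ {t m r} {A : Set} → t ≤ m → (A ⇔ r ≡ m) → (a? : Dec A) →
  ⟦ ⌊ a? ⌋ ⟧ + band t m r ≡ band t (suc m) r
band-suc {t} {m} t≤m A⇔r≡m (yes a) with refl ← Equivalence.to A⇔r≡m a with t ≤? m | m <? m | m <? suc m
... | _ | yes m<m | _ = contradiction m<m (n≮n m)
... | yes _ | no _ | yes _ = refl
... | yes _ | no _ | no m≮1+m = contradiction (n<1+n m) m≮1+m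
... | no t≰m | _ | _ = contradiction t≤m t≰m
band-suc {t} {m} {r} _ A⇔r≡m (no ¬a) with t ≤? r | r <? m | r <? suc m
... | no _ | _ | _ = refl
... | yes _ | yes _ | yes _ = refl
... | yes _ | no _ | no _ = refl
... | yes _ | yes r<m | no r≮1+m = contradiction (m<n⇒m<1+n r<m) r≮1+m
... | yes _ | no r≮m | yes r<1+m =
  contradiction (Equivalence.from A⇔r≡m (≤-antisym (≤-pred r<1+m) (≮⇒≥ r≮m))) ¬a

band-full : ∀ t {m r} → r < m → band t m r ≡ ⟦ ⌊ t ≤? r ⌋ ⟧
band-full t {m} {r} r<m with r <? m
... | yes _ = cong ⟦_⟧ (Boolₚ.∧-identityʳ _)
... | no r≮m = contradiction r<m r≮m

tabulate-∷ʳ : ∀ {a} {A : Set a} {m} (h : Fin (suc m) → A) →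
  List.tabulate h ≡ List.tabulate (h ∘ inject₁) ∷ʳ h (fromℕ m)
tabulate-∷ʳ {m = zero} h = refl
tabulate-∷ʳ {m = suc m} h = cong (h Fin.zero ∷_) (tabulate-∷ʳ (h ∘ Fin.suc))

reverse-tabulate : ∀ {a} {A : Set a} {m} (h : Fin (suc m) → A) →
  reverse (List.tabulate h) ≡ h (fromℕ m) ∷ reverse (List.tabulate (h ∘ inject₁))
reverse-tabulate {m = m} h =
  trans (cong reverse (tabulate-∷ʳ h)) (Listₚ.reverse-++ (List.tabulate (h ∘ inject₁)) [ h (fromℕ m) ])

addBasis : ∀ {n} → Vec ℕ n → Fin n → Vec ℕ n
addBasis w i = w +ᵥ e i

basisScan : ∀ {n} → Vec ℕ n → List (Fin n) → List (Vec ℕ n)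
basisScan = scanl addBasis

lookup-addBasis : ∀ {n} (u : Vec ℕ n) i c → lookup (addBasis u i) c ≡ lookup u c + ⟦ ⌊ i Finₚ.≟ c ⌋ ⟧
lookup-addBasis u i c = trans (lookup-zipWith _+_ c u (e i)) (cong (lookup u c +_) (lookup∘tabulate _ c))

-- Scanning reverse (tabulate h) adds e (h (m−1)), …, e (h 0) in turn; once the steps down to
-- h t are done, exactly the coordinates c with t ≤ ρ c < m have been raised.
module _ {n : ℕ} (ρ : Fin n → ℕ) where

  BandVertex : ℕ → Vec ℕ n → Vec ℕ n → Set
  BandVertex m u x = ∃[ t ] t ≤ m × ∀ c → lookup x c ≡ lookup u c + band t m (ρ c)

  Positions : ∀ {m} → (Fin m → Fin n) → Set
  Positions h = ∀ p c → h p ≡ c ⇔ ρ c ≡ toℕ p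

  private
    Positions-inject₁ : ∀ {m} {h : Fin (suc m) → Fin n} → Positions h → Positions (h ∘ inject₁)
    Positions-inject₁ {h = h} pos p c =
      subst (λ k → h (inject₁ p) ≡ c ⇔ ρ c ≡ k) (Finₚ.toℕ-inject₁ p) (pos (inject₁ p) c)

    band-addBasis : ∀ {m t} {h : Fin (suc m) → Fin n} → Positions h → t ≤ m → ∀ u c →
      lookup (addBasis u (h (fromℕ m))) c + band t m (ρ c) ≡ lookup u c + band t (suc m) (ρ c)
    band-addBasis {m} {t} {h} pos t≤m u c = begin
      lookup (addBasis u (h (fromℕ m))) c + band t m (ρ c)
        ≡⟨ cong (_+ band t m (ρ c)) (lookup-addBasis u _ c) ⟩
      lookup u c + ⟦ ⌊ h (fromℕ m) Finₚ.≟ c ⌋ ⟧ + band t m (ρ c)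
        ≡⟨ +-assoc (lookup u c) _ _ ⟩
      lookup u c + (⟦ ⌊ h (fromℕ m) Finₚ.≟ c ⌋ ⟧ + band t m (ρ c))
        ≡⟨ cong (lookup u c +_) (band-suc t≤m hit⇔ (h (fromℕ m) Finₚ.≟ c)) ⟩
      lookup u c + band t (suc m) (ρ c) ∎
      where
      open ≡-Reasoning
      hit⇔ : h (fromℕ m) ≡ c ⇔ ρ c ≡ m
      hit⇔ = subst (λ k → h (fromℕ m) ≡ c ⇔ ρ c ≡ k) (Finₚ.toℕ-fromℕ m) (pos (fromℕ m) c)

    +band-empty : ∀ m (u : Vec ℕ n) c → lookup u c + band m m (ρ c) ≡ lookup u c
    +band-empty m u c = trans (cong (lookup u c +_) (band-empty m (ρ c))) (+-identityʳ _)

    BandVertex-self : ∀ m u → BandVertex m u u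
    BandVertex-self m u = m , ≤-refl , λ c → sym (+band-empty m u c)

    empty-band⇒≡ : ∀ m {u x : Vec ℕ n} → (∀ c → lookup x c ≡ lookup u c + band m m (ρ c)) → x ≡ u
    empty-band⇒≡ m {u} coords = Pointwise-≡⇒≡ (ext λ c → trans (coords c) (+band-empty m u c))

    basisScan-reverse-tabulate : ∀ {m} (h : Fin (suc m) → Fin n) u →
      basisScan u (reverse (List.tabulate h))
        ≡ u ∷ basisScan (addBasis u (h (fromℕ m))) (reverse (List.tabulate (h ∘ inject₁)))
    basisScan-reverse-tabulate h u = cong (basisScan u) (reverse-tabulate h)

  basisScan⇒BandVertex : ∀ {m} (h : Fin m → Fin n) → Positions h → ∀ u {x} →
    x ∈ basisScan u (reverse (List.tabulate h)) → BandVertex m u x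
  basisScan⇒BandVertex {zero} h pos u (here refl) = BandVertex-self 0 u
  basisScan⇒BandVertex {suc m} h pos u {x} x∈ with subst (x ∈_) (basisScan-reverse-tabulate h u) x∈
  ... | here refl = BandVertex-self (suc m) u
  ... | there x∈′
    with basisScan⇒BandVertex (h ∘ inject₁) (Positions-inject₁ pos) (addBasis u (h (fromℕ m))) x∈′
  ...   | t , t≤m , coords = t , m≤n⇒m≤1+n t≤m , λ c → trans (coords c) (band-addBasis pos t≤m u c)

  BandVertex⇒basisScan : ∀ {m} (h : Fin m → Fin n) → Positions h → ∀ u {x} →
    BandVertex m u x → x ∈ basisScan u (reverse (List.tabulate h))
  BandVertex⇒basisScan {zero} h pos u (_ , z≤n , coords) = here (empty-band⇒≡ 0 coords)
  BandVertex⇒basisScan {suc m} h pos u {x} (t , t≤1+m , coords) =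
    subst (x ∈_) (sym (basisScan-reverse-tabulate h u)) x∈
    where
    x∈ : x ∈ u ∷ basisScan (addBasis u (h (fromℕ m))) (reverse (List.tabulate (h ∘ inject₁)))
    x∈ with m <? t
    ... | yes m<t rewrite ≤-antisym t≤1+m m<t = here (empty-band⇒≡ (suc m) coords)
    ... | no m≮t = there (BandVertex⇒basisScan (h ∘ inject₁) (Positions-inject₁ pos) _
            (t , ≮⇒≥ m≮t , λ c → trans (coords c) (sym (band-addBasis pos (≮⇒≥ m≮t) u c))))

FacetVertex : ∀ {n} → Vec ℕ n → Permutation′ n → Vec ℕ n → Set
FacetVertex {n} w π x = ∃[ t ] t ≤ n × ∀ c → lookup x c ≡ ⟦ ⌊ t ≤? toℕ (π ⟨$⟩ˡ c) ⌋ ⟧ + lookup w c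

facetVerts⇔ : ∀ {n} (w : Vec ℕ n) π {x} → x ∈ facetVerts w π ⇔ FacetVertex w π x
facetVerts⇔ {n} w π {x} = mk⇔ to from
  where
  ρ : Fin n → ℕ
  ρ c = toℕ (π ⟨$⟩ˡ c)

  positions : Positions ρ (π ⟨$⟩ʳ_)
  positions p c = mk⇔ (λ { refl → cong toℕ (inverseˡ π) })
                      (λ ρc≡p → trans (cong (π ⟨$⟩ʳ_) (sym (Finₚ.toℕ-injective ρc≡p))) (inverseʳ π))

  facetList : map (π ⟨$⟩ʳ_) (allFin n) ≡ List.tabulate (π ⟨$⟩ʳ_)
  facetList = Listₚ.map-tabulate id (π ⟨$⟩ʳ_)

  band≡threshold : ∀ t c → lookup w c + band t n (ρ c) ≡ ⟦ ⌊ t ≤? ρ c ⌋ ⟧ + lookup w c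
  band≡threshold t c =
    trans (cong (lookup w c +_) (band-full t (Finₚ.toℕ<n (π ⟨$⟩ˡ c)))) (+-comm (lookup w c) _)

  to : x ∈ facetVerts w π → FacetVertex w π x
  to x∈
    with basisScan⇒BandVertex ρ (π ⟨$⟩ʳ_) positions w (subst (λ l → x ∈ basisScan w (reverse l)) facetList x∈)
  ... | t , t≤n , coords = t , t≤n , λ c → trans (coords c) (band≡threshold t c)

  from : FacetVertex w π x → x ∈ facetVerts w π
  from (t , t≤n , coords) = subst (λ l → x ∈ basisScan w (reverse l)) (sym facetList)
    (BandVertex⇒basisScan ρ (π ⟨$⟩ʳ_) positions w
      (t , t≤n , λ c → trans (coords c) (sym (band≡threshold t c))))

threshold-≼ : ∀ {t t′} r a → t′ ≤ t → (⟦ ⌊ t ≤? r ⌋ ⟧ + a) ≼ (⟦ ⌊ t′ ≤? r ⌋ ⟧ + a)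
threshold-≼ {t} {t′} r a t′≤t = Equivalence.from ⟦s⟧+a≼⟦s′⟧+a⇔s≤s′ antitone
  where
  antitone : ⌊ t ≤? r ⌋ Bool.≤ ⌊ t′ ≤? r ⌋
  antitone with t ≤? r | t′ ≤? r
  ... | yes _ | yes _ = b≤b
  ... | yes t≤r | no t′≰r = contradiction (≤-trans t′≤t t≤r) t′≰r
  ... | no _ | yes _ = f≤t
  ... | no _ | no _ = b≤b

FacetVertex-comparable : ∀ {n} {w : Vec ℕ n} {π x y} → FacetVertex w π x → FacetVertex w π y →
  Comparable _≼ᵥ_ x y
FacetVertex-comparable {w = w} {π} (t , _ , x-coords) (t′ , _ , y-coords) with ≤-total t′ t
... | inj₁ t′≤t = inj₁ (ext λ c →
  subst₂ _≼_ (sym (x-coords c)) (sym (y-coords c)) (threshold-≼ _ (lookup w c) t′≤t))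
... | inj₂ t≤t′ = inj₂ (ext λ c →
  subst₂ _≼_ (sym (y-coords c)) (sym (x-coords c)) (threshold-≼ _ (lookup w c) t≤t′))

T-face⇒Chain : ∀ {n q σ} → T (suc n) q σ → Chain _≼ᵥ_ σ
T-face⇒Chain (w , π , _ , _ , σ⊆F) {x} {y} x∈ y∈ = FacetVertex-comparable {w = w} {π} {x} {y}
  (Equivalence.to (facetVerts⇔ w π) (All.lookup σ⊆F x∈))
  (Equivalence.to (facetVerts⇔ w π) (All.lookup σ⊆F y∈))

-- Chains through an interior vertex are faces

Linked-lower : ∀ {n a b} (v : Vec ℕ n) → Linked _<_ ((a ∷ toList v) ∷ʳ b) → ∀ c → a < lookup v c
Linked-lower (x Vec.∷ v) (a<x ∷ _) Fin.zero = a<x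
Linked-lower (x Vec.∷ v) (a<x ∷ rest) (Fin.suc c) = <-trans a<x (Linked-lower v rest c)

Linked-adjacent : ∀ {n a b} {R : Rel ℕ 0ℓ} (v : Vec ℕ n) → Linked R ((a ∷ toList v) ∷ʳ b) →
  ∀ i j → toℕ j ≡ suc (toℕ i) → R (lookup v i) (lookup v j)
Linked-adjacent (x Vec.∷ y Vec.∷ v) (_ ∷ xRy ∷ _) Fin.zero (Fin.suc Fin.zero) refl = xRy
Linked-adjacent (x Vec.∷ v) (_ ∷ rest) (Fin.suc i) (Fin.suc j) j≡1+i =
  Linked-adjacent v rest i j (suc-injective j≡1+i)

Linked-≼ᵥ : ∀ {n a a′ b} (w v : Vec ℕ n) → a′ ≤ a → w ≼ᵥ v →
  Linked _<_ ((a ∷ toList v) ∷ʳ b) → Linked _≤_ ((a′ ∷ toList w) ∷ʳ b)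
Linked-≼ᵥ Vec.[] Vec.[] a′≤a _ (a<b ∷ [-]) = ≤-trans a′≤a (<⇒≤ a<b) ∷ [-]
Linked-≼ᵥ (y Vec.∷ w) (x Vec.∷ v) a′≤a w≼v (a<x ∷ rest) =
  ≤-trans a′≤a (≤-pred (≤-trans a<x (≼⇒≤suc (app w≼v Fin.zero)))) ∷
  Linked-≼ᵥ w v (≼⇒≤ (app w≼v Fin.zero)) (Pointwise.tail w≼v) rest

module FacetOfChain {n q} (v : Vec ℕ n) (v-interior : Interior (suc n) q v)
                    (σ : List (Vec ℕ n)) (chain : Chain _≼ᵥ_ (v ∷ σ)) where

  minimizer : Fin n → Vec ℕ n
  minimizer c = argmin (λ x → lookup x c) v σ

  minimizer∈ : ∀ c → minimizer c ∈ v ∷ σ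
  minimizer∈ c with argmin-sel (λ x → lookup x c) v σ
  ... | inj₁ ≡v = here ≡v
  ... | inj₂ ∈σ = there ∈σ

  minimizer-≤ : ∀ c {x} → x ∈ v ∷ σ → lookup (minimizer c) c ≤ lookup x c
  minimizer-≤ c (here refl) = f[argmin]≤f[⊤] {f = λ x → lookup x c} v σ
  minimizer-≤ c (there x∈σ) = All.lookup (f[argmin]≤f[xs] {f = λ x → lookup x c} v σ) x∈σ

  floor : Vec ℕ n
  floor = tabulate λ c → lookup (minimizer c) c

  floor-≼ : ∀ {x} → x ∈ v ∷ σ → floor ≼ᵥ x
  floor-≼ {x} x∈ = ext λ c → subst (_≼ lookup x c) (sym (lookup∘tabulate (λ c → lookup (minimizer c) c) c))
    (Comparable⇒≼ (minimizer-≤ c x∈) (Comparable-lookup (chain (minimizer∈ c) x∈) c))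

  Raised : Vec ℕ n → Fin n → Set
  Raised x c = lookup x c ≡ suc (lookup floor c)

  Raised? : ∀ x c → Dec (Raised x c)
  Raised? x c = lookup x c ≟ suc (lookup floor c)

  Raised-≼ : ∀ {x y c} → y ∈ v ∷ σ → x ≼ᵥ y → Raised x c → Raised y c
  Raised-≼ {c = c} y∈ x≼y x-raised =
    a≼b∧1+a≼b⇒b≡1+a (app (floor-≼ y∈) c) (subst (_≼ _) x-raised (app x≼y c))

  height : Fin n → ℕ
  height c = length (filter (λ x → Raised? x c) (v ∷ σ))

  height-< : ∀ {x c c′} → x ∈ v ∷ σ → Raised x c → ¬ Raised x c′ → height c′ < height c
  height-< {x} {c} {c′} x∈ x-raised-c x-flat-c′ =
    length-filter-< (λ y → Raised? y c′) (λ y → Raised? y c) (v ∷ σ) c′⇒c x∈ x-raised-c x-flat-c′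
    where
    c′⇒c : ∀ {y} → y ∈ v ∷ σ → Raised y c′ → Raised y c
    c′⇒c y∈ y-raised-c′ with chain x∈ y∈
    ... | inj₁ x≼y = Raised-≼ y∈ x≼y x-raised-c
    ... | inj₂ y≼x = contradiction (Raised-≼ x∈ y≼x y-raised-c′) x-flat-c′

  open SortBy (×-strictTotalOrder <-strictTotalOrder <-strictTotalOrder) (λ c → height c , toℕ c)
              (λ (_ , toℕ-eq) → Finₚ.toℕ-injective toℕ-eq)

  position : Fin n → ℕ
  position c = toℕ (sorting ⟨$⟩ˡ c)

  Raised-upward : ∀ {x c c′} → x ∈ v ∷ σ → Raised x c → position c ≤ position c′ → Raised x c′
  Raised-upward {x} {c} {c′} x∈ x-raised-c pc≤pc′ with Raised? x c′
  ... | yes x-raised-c′ = x-raised-c′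
  ... | no x-flat-c′ =
    contradiction pc≤pc′ (<⇒≱ (sorting-monotone (inj₁ (height-< x∈ x-raised-c x-flat-c′))))

  member-FacetVertex : ∀ {x} → x ∈ v ∷ σ → FacetVertex floor sorting x
  member-FacetVertex {x} x∈ with upwardClosed-threshold (λ i → Raised? x (sorting ⟨$⟩ʳ i)) upward
    where
    upward : ∀ {i j} → toℕ i ≤ toℕ j → Raised x (sorting ⟨$⟩ʳ i) → Raised x (sorting ⟨$⟩ʳ j)
    upward {i} {j} i≤j raised = Raised-upward x∈ raised
      (subst₂ _≤_ (cong toℕ (sym (inverseˡ sorting))) (cong toℕ (sym (inverseˡ sorting))) i≤j)
  ... | t , t≤n , raised⇔ =
    t , t≤n , λ c → ≼⇒≡⟦P?⟧+a (app (floor-≼ x∈) c) (raised⇔′ c) (t ≤? position c)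
    where
    raised⇔′ : ∀ c → Raised x c ⇔ t ≤ position c
    raised⇔′ c = subst (λ d → Raised x d ⇔ t ≤ position c) (inverseʳ sorting) (raised⇔ (sorting ⟨$⟩ˡ c))

  floor-consistent : Consistent floor sorting
  floor-consistent i j j≡1+i wᵢ≡wⱼ
    with a≼b∧a≼b′∧b<b′⇒b≡a∧b′≡1+a (app (floor-≼ (here refl)) i)
           (subst (_≼ lookup v j) (sym wᵢ≡wⱼ) (app (floor-≼ (here refl)) j))
           (Linked-adjacent v v-interior i j j≡1+i)
  ... | vᵢ≡wᵢ , vⱼ≡1+wᵢ = sorting-monotone (inj₁ (height-< (here refl) v-raised-j v-flat-i))
    where
    v-raised-j : Raised v j
    v-raised-j = trans vⱼ≡1+wᵢ (cong suc wᵢ≡wⱼ)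
    v-flat-i : ¬ Raised v i
    v-flat-i v-raised-i = 1+n≢n (trans (sym v-raised-i) vᵢ≡wᵢ)

  T-face : T (suc n) q (v ∷ σ)
  T-face = floor , sorting , Linked-≼ᵥ floor v z≤n (floor-≼ (here refl)) v-interior , floor-consistent ,
         All.tabulate (Equivalence.from (facetVerts⇔ floor sorting) ∘ member-FacetVertex)

Chain⇒T-face : ∀ {n q} {v : Vec ℕ n} {σ} → Interior (suc n) q v → Chain _≼ᵥ_ (v ∷ σ) →
  T (suc n) q (v ∷ σ)
Chain⇒T-face {v = v} {σ} v-interior chain = FacetOfChain.T-face v v-interior σ chain

-- Coding the link by subsets

⊆⇔lookup-≤ : ∀ {n} {p q : Subset n} → p ⊆ q ⇔ (∀ i → lookup p i Bool.≤ lookup q i)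
⊆⇔lookup-≤ {p = p} {q} = mk⇔ to from
  where
  to : p ⊆ q → ∀ i → lookup p i Bool.≤ lookup q i
  to p⊆q i with lookup p i in pᵢ≡
  ... | false = Boolₚ.≤-minimum _
  ... | true = Boolₚ.≤-reflexive (sym ([]=⇒lookup (p⊆q (lookup⇒[]= i p pᵢ≡))))
  true≤⇒≡true : ∀ {b} → true Bool.≤ b → b ≡ true
  true≤⇒≡true b≤b = refl
  from : (∀ i → lookup p i Bool.≤ lookup q i) → p ⊆ q
  from p≤q {i} i∈p =
    lookup⇒[]= i q (true≤⇒≡true (subst (Bool._≤ lookup q i) ([]=⇒lookup i∈p) (p≤q i)))

module LinkCoding {n} (v : Vec ℕ n) (v-positive : ∀ c → 0 < lookup v c) where

  LinkVertex : Vec ℕ n → Set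
  LinkVertex x = x ≢ v × Comparable _≼ᵥ_ v x

  record InBox (b : Bool) (x : Vec ℕ n) : Set where
    constructor inBox
    field coord : ∀ c → (lookup v c ∸ ⟦ b ⟧) ≼ lookup x c

  open InBox

  -- b ∷ S codes v − b·𝟙 + 𝟙_S; the bit b of code x records whether x lies below v.
  vertex : Subset (suc n) → Vec ℕ n
  vertex (b Vec.∷ S) = tabulate λ c → ⟦ lookup S c ⟧ + (lookup v c ∸ ⟦ b ⟧)

  below : Vec ℕ n → Bool
  below x = ⌊ Finₚ.any? (λ c → lookup x c <? lookup v c) ⌋

  raisedSet : Bool → Vec ℕ n → Subset n
  raisedSet b x = tabulate λ c → ⌊ lookup x c ≟ suc (lookup v c ∸ ⟦ b ⟧) ⌋

  code : Vec ℕ n → Subset (suc n)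
  code x = below x Vec.∷ raisedSet (below x) x

  lookup-vertex : ∀ b S c → lookup (vertex (b Vec.∷ S)) c ≡ ⟦ lookup S c ⟧ + (lookup v c ∸ ⟦ b ⟧)
  lookup-vertex b S c = lookup∘tabulate _ c

  vertex-InBox : ∀ b S → InBox b (vertex (b Vec.∷ S))
  vertex-InBox b S = inBox λ c → lookup S c , lookup-vertex b S c

  raisedSet-vertex : ∀ b S → raisedSet b (vertex (b Vec.∷ S)) ≡ S
  raisedSet-vertex b S = Pointwise-≡⇒≡ (ext λ c → begin
    lookup (raisedSet b (vertex (b Vec.∷ S))) c
      ≡⟨ lookup∘tabulate _ c ⟩
    ⌊ lookup (vertex (b Vec.∷ S)) c ≟ suc (lookup v c ∸ ⟦ b ⟧) ⌋
      ≡⟨ cong (λ y → ⌊ y ≟ suc (lookup v c ∸ ⟦ b ⟧) ⌋) (lookup-vertex b S c) ⟩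
    ⌊ ⟦ lookup S c ⟧ + (lookup v c ∸ ⟦ b ⟧) ≟ suc (lookup v c ∸ ⟦ b ⟧) ⌋
      ≡⟨ ⌊⟦s⟧+a≟1+a⌋≡s (lookup S c) _ ⟩
    lookup S c ∎)
    where open ≡-Reasoning

  vertex-raisedSet : ∀ {b x} → InBox b x → vertex (b Vec.∷ raisedSet b x) ≡ x
  vertex-raisedSet {b} {x} box = Pointwise-≡⇒≡ (ext λ c → begin
    lookup (vertex (b Vec.∷ raisedSet b x)) c
      ≡⟨ lookup-vertex b (raisedSet b x) c ⟩
    ⟦ lookup (raisedSet b x) c ⟧ + (lookup v c ∸ ⟦ b ⟧)
      ≡⟨ cong (λ s → ⟦ s ⟧ + (lookup v c ∸ ⟦ b ⟧)) (lookup∘tabulate _ c) ⟩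
    ⟦ ⌊ lookup x c ≟ suc (lookup v c ∸ ⟦ b ⟧) ⌋ ⟧ + (lookup v c ∸ ⟦ b ⟧)
      ≡⟨ sym (≼⇒≡⟦P?⟧+a (coord box c) (mk⇔ id id) (lookup x c ≟ _)) ⟩
    lookup x c ∎)
    where open ≡-Reasoning

  vertex-injective : ∀ b S S′ → vertex (b Vec.∷ S) ≡ vertex (b Vec.∷ S′) → S ≡ S′
  vertex-injective b S S′ eq =
    trans (sym (raisedSet-vertex b S)) (trans (cong (raisedSet b) eq) (raisedSet-vertex b S′))

  vertex-replicate : ∀ b → vertex (replicate (suc n) b) ≡ v
  vertex-replicate b = Pointwise-≡⇒≡ (ext λ c →
    trans (lookup-vertex b (replicate n b) c)
          (trans (cong (λ s → ⟦ s ⟧ + (lookup v c ∸ ⟦ b ⟧)) (lookup-replicate c b))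
                 (⟦b⟧+[a∸⟦b⟧]≡a b (v-positive c))))

  vertex≢v : ∀ {p} → ProperNonempty p → vertex p ≢ v
  vertex≢v {false Vec.∷ S} ((i , i∈p) , _) eq =
    ∉⊥ (subst (i Subset.∈_)
              (cong (false Vec.∷_) (vertex-injective false S _ (trans eq (sym (vertex-replicate false)))))
              i∈p)
  vertex≢v {true Vec.∷ S} (_ , p≢⊤) eq =
    p≢⊤ (cong (true Vec.∷_) (vertex-injective true S _ (trans eq (sym (vertex-replicate true)))))

  below-InBox : ∀ {b x} → InBox b x → x ≢ v → below x ≡ b
  below-InBox {false} {x} box _ with Finₚ.any? (λ c → lookup x c <? lookup v c)
  ... | yes (c , xc<vc) = contradiction (≼⇒≤ (coord box c)) (<⇒≱ xc<vc)
  ... | no _ = refl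
  below-InBox {true} {x} box x≢v with Finₚ.any? (λ c → lookup x c <? lookup v c)
  ... | yes _ = refl
  ... | no none-below = contradiction (Pointwise-≡⇒≡ (ext λ c →
          ≤-antisym (≼⇒≤ (Equivalence.from (b≼a⇔a∸1≼b (v-positive c)) (coord box c)))
                    (≮⇒≥ (λ xc<vc → none-below (c , xc<vc)))))
        x≢v

  code-vertex : ∀ {p} → ProperNonempty p → code (vertex p) ≡ p
  code-vertex {b Vec.∷ S} pn rewrite below-InBox (vertex-InBox b S) (vertex≢v pn) =
    cong (b Vec.∷_) (raisedSet-vertex b S)

  vertex-code : ∀ {b x} → InBox b x → x ≢ v → vertex (code x) ≡ x
  vertex-code box x≢v rewrite below-InBox box x≢v = vertex-raisedSet box

  code-ProperNonempty : ∀ {b x} → InBox b x → x ≢ v → ProperNonempty (code x)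
  code-ProperNonempty {x = x} box x≢v = nonempty , code-constant true
    where
    code-constant : ∀ b′ → code x ≢ replicate (suc n) b′
    code-constant b′ eq =
      x≢v (trans (sym (vertex-code box x≢v)) (trans (cong vertex eq) (vertex-replicate b′)))
    nonempty : Nonempty (code x)
    nonempty with nonempty? (code x)
    ... | yes ne = ne
    ... | no empty = contradiction (Empty-unique empty) (code-constant false)

  Comparable⇔InBox : ∀ {x} → Comparable _≼ᵥ_ v x ⇔ (∃[ b ] InBox b x)
  Comparable⇔InBox {x} = mk⇔ to from
    where
    to : Comparable _≼ᵥ_ v x → ∃[ b ] InBox b x
    to (inj₁ v≼x) = false , inBox (app v≼x)
    to (inj₂ x≼v) = true , inBox λ c → Equivalence.to (b≼a⇔a∸1≼b (v-positive c)) (app x≼v c)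
    from : ∃[ b ] InBox b x → Comparable _≼ᵥ_ v x
    from (false , box) = inj₁ (ext (coord box))
    from (true , box) = inj₂ (ext λ c → Equivalence.from (b≼a⇔a∸1≼b (v-positive c)) (coord box c))

  LinkVertex-vertex : ∀ {p} → ProperNonempty p → LinkVertex (vertex p)
  LinkVertex-vertex {b Vec.∷ S} pn =
    vertex≢v pn , Equivalence.from Comparable⇔InBox (b , vertex-InBox b S)

  LinkVertex-code : ∀ {x} → LinkVertex x → ProperNonempty (code x) × vertex (code x) ≡ x
  LinkVertex-code {x} (x≢v , v∼x) with Equivalence.to Comparable⇔InBox v∼x
  ... | _ , box = code-ProperNonempty box x≢v , vertex-code box x≢v

  vertex-≼ᵥ⇔ : ∀ b S b′ S′ → vertex (b Vec.∷ S) ≼ᵥ vertex (b′ Vec.∷ S′) ⇔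
    (∀ c → (⟦ lookup S c ⟧ + (lookup v c ∸ ⟦ b ⟧)) ≼ (⟦ lookup S′ c ⟧ + (lookup v c ∸ ⟦ b′ ⟧)))
  vertex-≼ᵥ⇔ b S b′ S′ = mk⇔
    (λ x≼y c → subst₂ _≼_ (lookup-vertex b S c) (lookup-vertex b′ S′ c) (app x≼y c))
    (λ x≼y → ext λ c → subst₂ _≼_ (sym (lookup-vertex b S c)) (sym (lookup-vertex b′ S′ c)) (x≼y c))

  ⊆⇒Comparable : ∀ {p p′} → p ⊆ p′ → Comparable _≼ᵥ_ (vertex p) (vertex p′)
  ⊆⇒Comparable {false Vec.∷ S} {false Vec.∷ S′} p⊆p′ =
    inj₁ (Equivalence.from (vertex-≼ᵥ⇔ false S false S′) λ c →
    Equivalence.from ⟦s⟧+a≼⟦s′⟧+a⇔s≤s′ (Equivalence.to ⊆⇔lookup-≤ p⊆p′ (Fin.suc c)))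
  ⊆⇒Comparable {true Vec.∷ S} {true Vec.∷ S′} p⊆p′ =
    inj₁ (Equivalence.from (vertex-≼ᵥ⇔ true S true S′) λ c →
    Equivalence.from ⟦s⟧+a≼⟦s′⟧+a⇔s≤s′ (Equivalence.to ⊆⇔lookup-≤ p⊆p′ (Fin.suc c)))
  ⊆⇒Comparable {false Vec.∷ S} {true Vec.∷ S′} p⊆p′ =
    inj₂ (Equivalence.from (vertex-≼ᵥ⇔ true S′ false S) λ c →
    Equivalence.from (⟦s⟧+[a∸1]≼⟦s′⟧+a⇔s′≤s (v-positive c)) (Equivalence.to ⊆⇔lookup-≤ p⊆p′ (Fin.suc c)))
  ⊆⇒Comparable {true Vec.∷ _} {false Vec.∷ _} p⊆p′ with p⊆p′ Vec.here
  ... | ()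

  ≼ᵥ⇒Comparable : ∀ {p p′} → Nonempty p → vertex p ≼ᵥ vertex p′ → Comparable _⊆_ p p′
  ≼ᵥ⇒Comparable {false Vec.∷ S} {false Vec.∷ S′} _ x≼y = inj₁ (Equivalence.from ⊆⇔lookup-≤ λ where
    Fin.zero → b≤b
    (Fin.suc c) → Equivalence.to ⟦s⟧+a≼⟦s′⟧+a⇔s≤s′ (Equivalence.to (vertex-≼ᵥ⇔ false S false S′) x≼y c))
  ≼ᵥ⇒Comparable {true Vec.∷ S} {true Vec.∷ S′} _ x≼y = inj₁ (Equivalence.from ⊆⇔lookup-≤ λ where
    Fin.zero → b≤b
    (Fin.suc c) → Equivalence.to ⟦s⟧+a≼⟦s′⟧+a⇔s≤s′ (Equivalence.to (vertex-≼ᵥ⇔ true S true S′) x≼y c))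
  ≼ᵥ⇒Comparable {true Vec.∷ S} {false Vec.∷ S′} _ x≼y = inj₂ (Equivalence.from ⊆⇔lookup-≤ λ where
    Fin.zero → f≤t
    (Fin.suc c) → Equivalence.to (⟦s⟧+[a∸1]≼⟦s′⟧+a⇔s′≤s (v-positive c))
                                 (Equivalence.to (vertex-≼ᵥ⇔ true S false S′) x≼y c))
  ≼ᵥ⇒Comparable {false Vec.∷ S} {true Vec.∷ S′} (Fin.suc c , c∈S) x≼y
    with trans (sym ([]=⇒lookup c∈S))
               (⟦s⟧+a≼⟦s′⟧+[a∸1]⇒s≡false (v-positive c) (Equivalence.to (vertex-≼ᵥ⇔ false S true S′) x≼y c))
  ... | ()

  vertex-Comparable⇔ : ∀ {p p′} → Nonempty p → Nonempty p′ →
    Comparable _≼ᵥ_ (vertex p) (vertex p′) ⇔ Comparable _⊆_ p p′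
  vertex-Comparable⇔ {p} {p′} ne ne′ = mk⇔ to from
    where
    to : Comparable _≼ᵥ_ (vertex p) (vertex p′) → Comparable _⊆_ p p′
    to (inj₁ x≼y) = ≼ᵥ⇒Comparable ne x≼y
    to (inj₂ y≼x) = swap (≼ᵥ⇒Comparable ne′ y≼x)
    from : Comparable _⊆_ p p′ → Comparable _≼ᵥ_ (vertex p) (vertex p′)
    from (inj₁ p⊆p′) = ⊆⇒Comparable p⊆p′
    from (inj₂ p′⊆p) = swap (⊆⇒Comparable p′⊆p)

  code-Comparable⇔ : ∀ {x y} → LinkVertex x → LinkVertex y →
    Comparable _≼ᵥ_ x y ⇔ Comparable _⊆_ (code x) (code y)
  code-Comparable⇔ {x} {y} x-link y-link with LinkVertex-code x-link | LinkVertex-code y-link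
  ... | (pn , x≡) | (pn′ , y≡) =
    subst₂ (λ x′ y′ → Comparable _≼ᵥ_ x′ y′ ⇔ Comparable _⊆_ (code x) (code y)) x≡ y≡
           (vertex-Comparable⇔ (proj₁ pn) (proj₁ pn′))

module _ {n q} (v : Vec ℕ n) (v-interior : Interior (suc n) q v) where

  open LinkCoding v (Linked-lower v v-interior)

  Link⇔Chain : ∀ {σ} → Link (T (suc n) q) v σ ⇔ (v ∉ σ × Chain _≼ᵥ_ (v ∷ σ))
  Link⇔Chain = mk⇔ (λ (v∉σ , face) → v∉σ , T-face⇒Chain face)
                   (λ (v∉σ , chain) → v∉σ , Chain⇒T-face v-interior chain)

  Link-vertex⇔ : ∀ {x} → Link (T (suc n) q) v [ x ] ⇔ LinkVertex x
  Link-vertex⇔ {x} = mk⇔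
    (λ link → let v∉[x] , chain = Equivalence.to Link⇔Chain link in
              (λ x≡v → v∉[x] (here (sym x≡v))) , chain (here refl) (there (here refl)))
    (λ (x≢v , v∼x) → Equivalence.from (Link⇔Chain {[ x ]})
      ((λ { (here v≡x) → x≢v (sym v≡x) }) ,
       Chain-∷⁺ ≼ᵥ-refl (λ { (here refl) → v∼x }) (Chain-[-] ≼ᵥ-refl)))

  Link-face⇔ : ∀ {σ} → All (λ x → Link (T (suc n) q) v [ x ]) σ →
    Link (T (suc n) q) v σ ⇔ Chain _≼ᵥ_ σ
  Link-face⇔ {σ} σ-vertices = mk⇔ to from
    where
    link-vertex : ∀ {x} → x ∈ σ → LinkVertex x
    link-vertex x∈σ = Equivalence.to Link-vertex⇔ (All.lookup σ-vertices x∈σ)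
    v∉σ : v ∉ σ
    v∉σ v∈σ = proj₁ (link-vertex v∈σ) refl
    to : Link (T (suc n) q) v σ → Chain _≼ᵥ_ σ
    to link = Chain-∷⁻ (proj₂ (Equivalence.to Link⇔Chain link))
    from : Chain _≼ᵥ_ σ → Link (T (suc n) q) v σ
    from chain = Equivalence.from Link⇔Chain (v∉σ , Chain-∷⁺ ≼ᵥ-refl (proj₂ ∘ link-vertex) chain)

  link≅orderComplex : Link (T (suc n) q) v ≅ OrderComplex {Subset (suc n)} ProperNonempty _⊆_
  link≅orderComplex = record
    { to = code
    ; from = vertex
    ; to-vert = λ x link → (code-PN link All.∷ All.[]) , Chain-[-] {R = _⊆_} ⊆-refl
    ; from-vert = λ p oc → Equivalence.from Link-vertex⇔ (LinkVertex-vertex (All.head (proj₁ oc)))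
    ; from∘to = λ x link → proj₂ (LinkVertex-code (Equivalence.to Link-vertex⇔ link))
    ; to∘from = λ p oc → code-vertex (All.head (proj₁ oc))
    ; faces = faces
    }
    where
    code-PN : ∀ {x} → Link (T (suc n) q) v [ x ] → ProperNonempty (code x)
    code-PN link = proj₁ (LinkVertex-code (Equivalence.to Link-vertex⇔ link))
    faces : ∀ σ → All (λ x → Link (T (suc n) q) v [ x ]) σ →
            Link (T (suc n) q) v σ ⇔ OrderComplex ProperNonempty _⊆_ (map code σ)
    faces σ σ-vertices = ⇔-trans (Link-face⇔ σ-vertices) (⇔-trans chain⇔ (mk⇔ (all-PN ,_) proj₂))
      where
      all-PN : All ProperNonempty (map code σ)
      all-PN = Allₚ.map⁺ (All.map code-PN σ-vertices)
      chain⇔ : Chain _≼ᵥ_ σ ⇔ Chain _⊆_ (map code σ)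
      chain⇔ = Chain-map⇔ code λ x∈ y∈ →
        code-Comparable⇔ (Equivalence.to Link-vertex⇔ (All.lookup σ-vertices x∈))
                         (Equivalence.to Link-vertex⇔ (All.lookup σ-vertices y∈))

mainTheorem1 : (k q : ℕ) → 2 ≤ k → 1 ≤ q → (v : Vec ℕ (k ∸ 1)) →
    InW k q v → Interior k q v →
    Link (T k q) v ≅ OrderComplex {Subset k} ProperNonempty _⊆_
-- InW v and 1 ≤ q are implied by the interiority of v.
mainTheorem1 zero _ () _ _ _ _
mainTheorem1 (suc n) q _ _ v _ v-interior = link≅orderComplex v v-interior
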